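{- Let $\Gamma$ be a graph and $v_0$ a vertex of $\Gamma$. Suppose $g\colon\mathbf R\to\mathbf{QD}_{v_0}(\Gamma)$ is an injective morphism of ranked posets. Then $g(\alpha_1)=(\{e_1,e_2\},D)$ for some parallel edges $e_1,e_2$ of $\Gamma$ and some $D\in\mathbf{QD}_{v_0}(\Gamma,\{e_1,e_2\})$, and $g(\mathbf R)=\mathbf R_{e_1,e_2}(D)$.
   Context: Graphs are finite, loops and multiple edges allowed, with weights $w\colon V(\Gamma)\to\mathbb Z_{\ge0}$ and genus $g_\Gamma=b_1(\Gamma)+\sum w(v)$; $\mathrm{val}(v)$ counts loops twice. Two edges are parallel if there are two vertices each incident to both. For $\mathcal E\subset E(\Gamma)$, $\Gamma^{\mathcal E}$ is obtained by inserting one vertex $v_e$ in the interior of each $e\in\mathcal E$. A pseudo-divisor is $(\mathcal E,D)$ with $D\colon V(\Gamma^{\mathcal E})\to\mathbb Z$, $D(v_e)=1$ for $e\in\mathcal E$. For $e\in\mathcal E$ and a vertex $s$, $D-v_e+s$ is the divisor on $\Gamma^{\mathcal E\setminus\{e\}}$ obtained by deleting $v_e$ and adding $1$ at $s$. Order: $(\mathcal E,D)\ge(\mathcal E',D')$ iff $\mathcal E'\subset\mathcal E$ and there is $\varphi\colon\mathcal E\setminus\mathcal E'\to V(\Gamma)$, $\varphi(e)$ an end-vertex of $e$, with $D'(v)=D(v)+|\varphi^{ -1}(v)|$ for $v\in V(\Gamma)$. Canonical polarization $\mu(v)=w(v)-1+\mathrm{val}(v)/2$ on $V(\Gamma)$,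 $0$ on exceptional vertices; $(\mathcal E,D)$ of degree $g_\Gamma-1$ is $v_0$-quasistable if $D(V)-\mu(V)+\delta_V/2\ge0$ for all nonempty $V\subset V(\Gamma^{\mathcal E})$, strictly when $v_0\notin V$ ($\delta_V$ = number of edges of $\Gamma^{\mathcal E}$ between $V$ and its complement). $\mathbf{QD}_{v_0}(\Gamma)$ is the poset of these, ranked by $|\mathcal E|$, and $\mathbf{QD}_{v_0}(\Gamma,\mathcal E)=\{D:(\mathcal E,D)\in\mathbf{QD}_{v_0}(\Gamma)\}$. $\mathbf R=\{\alpha_1,\beta_1,\dots,\beta_4,\gamma_1,\gamma_2,\gamma_3\}$ is the ranked poset whose cover relations are: $\alpha_1$ covers $\beta_1,\beta_2,\beta_3,\beta_4$; $\beta_1$ and $\beta_2$ cover $\gamma_1,\gamma_2$; $\beta_3$ and $\beta_4$ cover $\gamma_2,\gamma_3$ (ranks 2,1,0). For parallel edges $e_1,e_2$ with end-vertices $s,t$ and $D\in\mathbf{QD}_{v_0}(\Gamma,\{e_1,e_2\})$, $\mathbf R_{e_1,e_2}(D)$ is the subposet of $\mathbf{QD}_{v_0}(\Gamma)$ consisting of $(\{e_1,e_2\},D)$, $(\{e_1\},D-v_{e_2}+s)$, $(\{e_1\},D-v_{e_2}+t)$, $(\{e_2\},D-v_{e_1}+s)$, $(\{e_2\},D-v_{e_1}+t)$, $(\emptyset,D-v_{e_1}-v_{e_2}+2s)$, $(\emptyset,D-v_{e_1}-v_{e_2}+s+t)$, $(\emptyset,D-v_{e_1}-v_{e_2}+2t)$.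 A morphism of ranked posets is order-preserving and rank-preserving. -}

module Defs where

open import Data.Bool using (Bool; true; false; _∧_; _∨_; not; if_then_else_)
open import Data.Nat as ℕ using (ℕ; zero; suc)
open import Data.Integer as ℤ using (ℤ; +_; _+_; _-_; _*_; _≤_; _<_)
open import Data.Fin using (Fin; zero; suc; _≟_; _<?_)
open import Data.Fin.Subset using (Subset; _∈_; _∉_; _⊆_; ∣_∣; ⁅_⁆; _∪_)
open import Data.Vec using (Vec; lookup; tabulate; updateAt)
open import Data.Product using (Σ; ∃; _×_; _,_)
open import Data.Sum using (_⊎_)
open import Data.List using (List; []; _∷_)
open import Relation.Nullary using (¬_)
open import Relation.Nullary.Decidable using (⌊_⌋)
open import Relation.Binary.PropositionalEquality using (_≡_)
open import Relation.Binary.Construct.Closure.ReflexiveTransitive using (Star)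

sumF : {k : ℕ} → (Fin k → ℤ) → ℤ
sumF {zero}  f = + 0
sumF {suc k} f = f zero + sumF (λ i → f (suc i))

countF : {k : ℕ} → (Fin k → Bool) → ℕ
countF {zero}  f = 0
countF {suc k} f = (if f zero then 1 else 0) ℕ.+ countF (λ i → f (suc i))

anyF : {k : ℕ} → (Fin k → Bool) → Bool
anyF {zero}  f = false
anyF {suc k} f = f zero ∨ anyF (λ i → f (suc i))

[_] : Bool → ℤ
[ b ] = if b then + 1 else + 0

eqF : {k : ℕ} → Fin k → Fin k → Bool
eqF i j = ⌊ i ≟ j ⌋

xor : Bool → Bool → Bool
xor a b = if a then not b else b

record Graph : Set where
  field
    nV  : ℕ
    nE  : ℕ
    src : Fin nE → Fin nV
    tgt : Fin nE → Fin nV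
    w   : Fin nV → ℕ

module _ (Γ : Graph) where
  open Graph Γ

  Vertex : Set
  Vertex = Fin nV

  Edge : Set
  Edge = Fin nE

  Incident : Vertex → Edge → Set
  Incident v e = (src e ≡ v) ⊎ (tgt e ≡ v)

  Parallel : Edge → Edge → Set
  Parallel e₁ e₂ = Σ Vertex λ s → Σ Vertex λ t →
    ¬ (s ≡ t) × Incident s e₁ × Incident t e₁ × Incident s e₂ × Incident t e₂

  -- valence (loops counted twice)
  val : Vertex → ℕ
  val v = countF (λ e → eqF (src e) v) ℕ.+ countF (λ e → eqF (tgt e) v)

  adj : Vertex → Vertex → Bool
  adj v u = anyF (λ e → (eqF (src e) v ∧ eqF (tgt e) u) ∨ (eqF (tgt e) v ∧ eqF (src e) u))

  step : (Vertex → Bool) → (Vertex → Bool)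
  step S u = S u ∨ anyF (λ v → S v ∧ adj v u)

  iter : ℕ → (Vertex → Bool) → (Vertex → Bool)
  iter zero    S = S
  iter (suc k) S = step (iter k S)

  -- the set of vertices reachable from v (paths have length < nV)
  component : Vertex → (Vertex → Bool)
  component v = iter nV (eqF v)

  isRep : Vertex → Bool
  isRep v = not (anyF (λ u → component v u ∧ ⌊ u <? v ⌋))

  nComponents : ℕ
  nComponents = countF isRep

  b₁ : ℤ
  b₁ = (+ nE) - (+ nV) + (+ nComponents)

  genus : ℤ
  genus = b₁ + sumF (λ v → + (w v))

  -- Pseudo-divisors (ℰ , D).  Since D(v_e) = 1 is forced for e ∈ ℰ, D is
  -- recorded by its values on the original vertices V(Γ).

  record PDiv : Set where
    constructor pdiv
    field
      ℰ   : Subset nE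
      Dv  : Vec ℤ nV

  open PDiv public

  inℰ : PDiv → Edge → Bool
  inℰ p e = lookup (ℰ p) e

  rank : PDiv → ℕ
  rank p = ∣ ℰ p ∣

  degree : PDiv → ℤ
  degree p = sumF (lookup (Dv p)) + (+ ∣ ℰ p ∣)

  -- twice the canonical polarization on original vertices:
  -- 2μ(v) = 2w(v) - 2 + val(v); μ = 0 on exceptional vertices
  twoμ : Vertex → ℤ
  twoμ v = (+ 2) * (+ w v) - (+ 2) + (+ val v)

  -- A subset V of V(Γ^ℰ) is given by S ⊆ V(Γ) and T ⊆ ℰ (exceptional
  -- vertices v_e, e ∈ T).  δ_V = number of edges of Γ^ℰ between V and its
  -- complement: an edge e ∉ ℰ contributes [src e ∈ S xor tgt e ∈ S]; an
  -- edge e ∈ ℰ is subdivided into src e — v_e — tgt e and contributes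
  -- [src e ∈ S xor e ∈ T] + [tgt e ∈ S xor e ∈ T].
  δ : PDiv → (Vertex → Bool) → (Edge → Bool) → ℤ
  δ p S T = sumF (λ e → if inℰ p e
                          then [ xor (S (src e)) (T e) ] + [ xor (S (tgt e)) (T e) ]
                          else [ xor (S (src e)) (S (tgt e)) ])

  -- 2 (D(V) - μ(V)) + δ_V   (twice the quantity in the definition)
  twiceSlack : PDiv → (Vertex → Bool) → (Edge → Bool) → ℤ
  twiceSlack p S T =
    (+ 2) * (sumF (λ v → if S v then lookup (Dv p) v else + 0)
             + (+ countF T))
    - sumF (λ v → if S v then twoμ v else + 0)
    + δ p S T

  QuasiStable : Vertex → PDiv → Set
  QuasiStable v₀ p =
    (degree p ≡ genus - + 1) ×
    ((S : Vertex → Bool) (T : Edge → Bool) →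
       (∀ e → T e ≡ true → inℰ p e ≡ true) →
       (anyF S ≡ true ⊎ anyF T ≡ true) →
       (S v₀ ≡ true  → + 0 ≤ twiceSlack p S T) ×
       (S v₀ ≡ false → + 0 < twiceSlack p S T))

  -- order on pseudo-divisors:  q ≤Q p  iff  p ≥ q  iff  ℰ(q) ⊆ ℰ(p) and
  -- there is φ : ℰ(p) ∖ ℰ(q) → V(Γ) with φ(e) an end-vertex of e and
  -- D_q(v) = D_p(v) + |φ⁻¹(v)|.  (φ is given as a total function on edges;
  -- only its values on ℰ(p) ∖ ℰ(q) matter.)
  _≤Q_ : PDiv → PDiv → Set
  q ≤Q p = (ℰ q ⊆ ℰ p) ×
    Σ (Edge → Vertex) λ φ →
      (∀ e → inℰ p e ≡ true → inℰ q e ≡ false → Incident (φ e) e) ×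
      (∀ v → lookup (Dv q) v ≡
               lookup (Dv p) v
               + (+ countF (λ e → inℰ p e ∧ not (inℰ q e) ∧ eqF (φ e) v)))

  -- the subposet R_{e₁,e₂}(D), where s, t are the end-vertices of e₁, e₂

  addAt : Vertex → Vec ℤ nV → Vec ℤ nV
  addAt s D = updateAt D s (λ z → z + + 1)

  RList : Edge → Edge → Vertex → Vertex → Vec ℤ nV → List PDiv
  RList e₁ e₂ s t D =
      pdiv (⁅ e₁ ⁆ ∪ ⁅ e₂ ⁆) D
    ∷ pdiv ⁅ e₁ ⁆ (addAt s D)
    ∷ pdiv ⁅ e₁ ⁆ (addAt t D)
    ∷ pdiv ⁅ e₂ ⁆ (addAt s D)
    ∷ pdiv ⁅ e₂ ⁆ (addAt t D)
    ∷ pdiv (tabulate (λ _ → false)) (addAt s (addAt s D))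
    ∷ pdiv (tabulate (λ _ → false)) (addAt s (addAt t D))
    ∷ pdiv (tabulate (λ _ → false)) (addAt t (addAt t D))
    ∷ []

data 𝐑 : Set where
  α₁ β₁ β₂ β₃ β₄ γ₁ γ₂ γ₃ : 𝐑

rank𝐑 : 𝐑 → ℕ
rank𝐑 α₁ = 2
rank𝐑 β₁ = 1
rank𝐑 β₂ = 1
rank𝐑 β₃ = 1
rank𝐑 β₄ = 1
rank𝐑 γ₁ = 0
rank𝐑 γ₂ = 0
rank𝐑 γ₃ = 0

data _⋖_ : 𝐑 → 𝐑 → Set where
  β₁⋖α₁ : β₁ ⋖ α₁
  β₂⋖α₁ : β₂ ⋖ α₁
  β₃⋖α₁ : β₃ ⋖ α₁
  β₄⋖α₁ : β₄ ⋖ α₁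
  γ₁⋖β₁ : γ₁ ⋖ β₁
  γ₂⋖β₁ : γ₂ ⋖ β₁
  γ₁⋖β₂ : γ₁ ⋖ β₂
  γ₂⋖β₂ : γ₂ ⋖ β₂
  γ₂⋖β₃ : γ₂ ⋖ β₃
  γ₃⋖β₃ : γ₃ ⋖ β₃
  γ₂⋖β₄ : γ₂ ⋖ β₄
  γ₃⋖β₄ : γ₃ ⋖ β₄

_≤𝐑_ : 𝐑 → 𝐑 → Set
_≤𝐑_ = Star _⋖_

{-# OPTIONS --safe #-}
module Submission where

-- Every element of 𝐑 lies below α₁, and g α₁ = ({e₁, e₂}, D).  Going down in QD
-- removes exceptional vertices and puts their chip on an end-vertex of the edge,
-- so the four rank-one images lie among the four pseudo-divisors ({eᵢ}, D + one
-- end of the other edge); being distinct, they are all of them, which forces e₁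
-- and e₂ to be non-loops.  g γ₂ lies below both candidates supported on e₁, so its
-- divisor is D + src e₂ + (an end of e₁) and also D + tgt e₂ + (an end of e₁):
-- cancelling shows that both ends of e₂ are ends of e₁.  Then g maps 𝐑 injectively
-- into the eight-element list R_{e₁,e₂}(D), hence onto it.

open import Defs
open import Data.Bool using (Bool; true; false; _∧_; _∨_; not; if_then_else_)
open import Data.Bool.Properties using (∧-assoc; ∧-identityʳ; ∧-zeroʳ; ∧-distribʳ-∨)
open import Data.Empty using (⊥-elim)
open import Data.Nat as ℕ using (ℕ; zero; suc)
import Data.Nat.Properties as ℕ
open import Data.Fin using (Fin; zero; suc; _≟_; _<_; _↑ˡ_; punchOut)
import Data.Fin.Properties as Fin
open import Data.Fin.Subset using (Subset; ⁅_⁆; _∪_; ∣_∣; _⊆_; ⊥)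
open import Data.Fin.Subset.Properties using (x∈⁅x⁆; x∈⁅y⁆⇒x≡y; x∈p∪q⁻; ∪-identityˡ; ∪-comm)
open import Data.Integer as ℤ using (ℤ; +_; _+_)
import Data.Integer.Properties as ℤ
open import Algebra.Properties.AbelianGroup ℤ.+-0-abelianGroup using (∙-cancelˡ)
open import Data.List as List using (List)
open import Data.List.Membership.Propositional using (_∈_)
open import Data.List.Relation.Unary.Any using (here; there; index)
open import Data.List.Relation.Unary.Any.Properties using (lookup-index)
open import Data.Product using (Σ; ∃; ∃₂; _×_; _,_; proj₁; proj₂; uncurry)
import Data.Product as Product
open import Data.Sum using (_⊎_; inj₁; inj₂)
import Data.Sum as Sum
open import Data.Vec using (Vec; []; _∷_; lookup; tabulate; allFin)
open import Data.Vec.Properties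
  using (lookup∘updateAt; lookup∘updateAt′; lookup-zipWith; lookup-replicate; tabulate-allFin; map-const)
open import Data.Vec.Relation.Binary.Pointwise.Extensional using (ext; Pointwise-≡⇒≡)
open import Function using (_∘_; _⇔_; mk⇔)
open import Function.Definitions using (Injective)
open import Relation.Binary.Construct.Closure.ReflexiveTransitive using (ε; _◅_)
open import Relation.Binary.PropositionalEquality
open import Relation.Nullary using (¬_; yes; no)
open import Relation.Nullary.Decidable using (dec-true; isYes≗does)

𝟙 : Bool → ℕ
𝟙 b = if b then 1 else 0

eqF-refl : ∀ {n} (a : Fin n) → eqF a a ≡ true
eqF-refl a = trans (isYes≗does (a ≟ a)) (dec-true (a ≟ a) refl)

eqF-≢ : ∀ {n} {a b : Fin n} → a ≢ b → eqF a b ≡ false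
eqF-≢ {a = a} {b} a≢b with a ≟ b
... | yes a≡b = ⊥-elim (a≢b a≡b)
... | no _    = refl

eqF⇒≡ : ∀ {n} {a b : Fin n} → eqF a b ≡ true → a ≡ b
eqF⇒≡ {a = a} {b} eq with a ≟ b
... | yes a≡b = a≡b

eqF-suc : ∀ {n} (a i : Fin n) → eqF (suc a) (suc i) ≡ eqF a i
eqF-suc a i with a ≟ i
... | yes _ = refl
... | no _  = refl

eqF-disjoint : ∀ {n} {a b : Fin n} → a ≢ b → ∀ e (h : Fin n → Bool) →
  (eqF a e ∧ h e) ∧ (eqF b e ∧ h e) ≡ false
eqF-disjoint {a = a} {b} a≢b e h with a ≟ e | b ≟ e
... | yes refl | yes refl = ⊥-elim (a≢b refl)
... | yes refl | no _     = ∧-zeroʳ (h a)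
... | no _     | _        = refl

∧-not≡true : ∀ {x y} → x ∧ not y ≡ true → x ≡ true × y ≡ false
∧-not≡true {true} {false} _ = refl , refl

𝟙≡suc⇒true : ∀ {b n} → 𝟙 b ≡ suc n → b ≡ true
𝟙≡suc⇒true {true} _ = refl

countF-false : ∀ k → countF {k} (λ _ → false) ≡ 0
countF-false zero    = refl
countF-false (suc k) = countF-false k

countF-cong : ∀ {k} {f h : Fin k → Bool} → (∀ i → f i ≡ h i) → countF f ≡ countF h
countF-cong {zero}  _   = refl
countF-cong {suc k} f≗h = cong₂ (λ b n → 𝟙 b ℕ.+ n) (f≗h zero) (countF-cong (f≗h ∘ suc))

countF-singleton : ∀ {k} (a : Fin k) (h : Fin k → Bool) →
  countF (λ i → eqF a i ∧ h i) ≡ 𝟙 (h a)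
countF-singleton {suc k} zero h =
  trans (cong (𝟙 (h zero) ℕ.+_) (countF-false k)) (ℕ.+-identityʳ _)
countF-singleton {suc k} (suc a) h =
  trans (countF-cong (λ i → cong (_∧ h (suc i)) (eqF-suc a i))) (countF-singleton a (h ∘ suc))

countF-∨ : ∀ {k} (f h : Fin k → Bool) → (∀ i → f i ∧ h i ≡ false) →
  countF (λ i → f i ∨ h i) ≡ countF f ℕ.+ countF h
countF-∨ {zero} _ _ _ = refl
countF-∨ {suc k} f h disjoint
  with f zero | h zero | disjoint zero | countF-∨ (f ∘ suc) (h ∘ suc) (disjoint ∘ suc)
... | false | false | _ | ih = ih
... | false | true  | _ | ih = trans (cong suc ih) (sym (ℕ.+-suc _ _))
... | true  | false | _ | ih = cong suc ih
... | true  | true  | () | _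

lookup-⁅⁆ : ∀ {n} (x i : Fin n) → lookup ⁅ x ⁆ i ≡ eqF x i
lookup-⁅⁆ zero    zero    = refl
lookup-⁅⁆ zero    (suc i) = lookup-replicate i false
lookup-⁅⁆ (suc x) zero    = refl
lookup-⁅⁆ (suc x) (suc i) = trans (lookup-⁅⁆ x i) (sym (eqF-suc x i))

lookup-⁅⁆∪⁅⁆ : ∀ {n} (x y i : Fin n) → lookup (⁅ x ⁆ ∪ ⁅ y ⁆) i ≡ eqF x i ∨ eqF y i
lookup-⁅⁆∪⁅⁆ x y i =
  trans (lookup-zipWith _∨_ i ⁅ x ⁆ ⁅ y ⁆) (cong₂ _∨_ (lookup-⁅⁆ x i) (lookup-⁅⁆ y i))

tabulate-false≡⊥ : ∀ {n} → tabulate {n = n} (λ _ → false) ≡ ⊥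
tabulate-false≡⊥ {n} = trans (tabulate-allFin _) (map-const (allFin n) false)

∣p∣≡0⇒p≡⊥ : ∀ {n} (p : Subset n) → ∣ p ∣ ≡ 0 → p ≡ ⊥
∣p∣≡0⇒p≡⊥ []          _ = refl
∣p∣≡0⇒p≡⊥ (false ∷ p) h = cong (false ∷_) (∣p∣≡0⇒p≡⊥ p h)

∣p∣≡1⇒p≡⁅x⁆ : ∀ {n} (p : Subset n) → ∣ p ∣ ≡ 1 → ∃ λ x → p ≡ ⁅ x ⁆
∣p∣≡1⇒p≡⁅x⁆ (true  ∷ p) h = zero , cong (true ∷_) (∣p∣≡0⇒p≡⊥ p (ℕ.suc-injective h))
∣p∣≡1⇒p≡⁅x⁆ (false ∷ p) h = Product.map suc (cong (false ∷_)) (∣p∣≡1⇒p≡⁅x⁆ p h)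

∣p∣≡2⇒p≡⁅x⁆∪⁅y⁆ : ∀ {n} (p : Subset n) → ∣ p ∣ ≡ 2 →
  ∃₂ λ x y → x ≢ y × p ≡ ⁅ x ⁆ ∪ ⁅ y ⁆
∣p∣≡2⇒p≡⁅x⁆∪⁅y⁆ (true ∷ p) h with ∣p∣≡1⇒p≡⁅x⁆ p (ℕ.suc-injective h)
... | y , refl = zero , suc y , (λ ()) , cong (true ∷_) (sym (∪-identityˡ ⁅ y ⁆))
∣p∣≡2⇒p≡⁅x⁆∪⁅y⁆ (false ∷ p) h with ∣p∣≡2⇒p≡⁅x⁆∪⁅y⁆ p h
... | x , y , x≢y , refl = suc x , suc y , x≢y ∘ Fin.suc-injective , refl

⁅z⁆⊆⁅x⁆∪⁅y⁆ : ∀ {n} {z x y : Fin n} → ⁅ z ⁆ ⊆ ⁅ x ⁆ ∪ ⁅ y ⁆ → z ≡ x ⊎ z ≡ y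
⁅z⁆⊆⁅x⁆∪⁅y⁆ {z = z} {x} {y} sub =
  Sum.map (x∈⁅y⁆⇒x≡y x) (x∈⁅y⁆⇒x≡y y) (x∈p∪q⁻ ⁅ x ⁆ ⁅ y ⁆ (sub (x∈⁅x⁆ z)))

∣p∣≡1∧p⊆⁅x⁆∪⁅y⁆ : ∀ {n} {p : Subset n} {x y} → ∣ p ∣ ≡ 1 → p ⊆ ⁅ x ⁆ ∪ ⁅ y ⁆ →
  p ≡ ⁅ x ⁆ ⊎ p ≡ ⁅ y ⁆
∣p∣≡1∧p⊆⁅x⁆∪⁅y⁆ {p = p} size sub with ∣p∣≡1⇒p≡⁅x⁆ p size
... | z , refl = Sum.map (cong ⁅_⁆) (cong ⁅_⁆) (⁅z⁆⊆⁅x⁆∪⁅y⁆ sub)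

injective⇒surjective : ∀ {n} (f : Fin n → Fin n) → Injective _≡_ _≡_ f →
  ∀ c → ∃ λ i → f i ≡ c
injective⇒surjective {suc n} f f-injective c with Fin.any? (λ i → f i ≟ c)
... | yes hit    = hit
... | no c∉image = ⊥-elim (collision (Fin.pigeonhole (ℕ.n<1+n n) (λ i → punchOut (miss i))))
  where
  miss : ∀ i → c ≢ f i
  miss i = c∉image ∘ (i ,_) ∘ sym

  collision : ¬ ∃₂ λ i j → i < j × punchOut (miss i) ≡ punchOut (miss j)
  collision (i , j , i<j , same) =
    Fin.<-irrefl (f-injective (Fin.punchOut-injective (miss i) (miss j) same)) i<j

module InjectionIntoFamily {a} {A : Set a} {n} (f family : Fin n → A)
  (f-injective : Injective _≡_ _≡_ f) (classify : ∀ i → ∃ λ c → f i ≡ family c) where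

  private
    code : Fin n → Fin n
    code i = proj₁ (classify i)

    code-injective : Injective _≡_ _≡_ code
    code-injective {i} {j} eq =
      f-injective (trans (proj₂ (classify i)) (trans (cong family eq) (sym (proj₂ (classify j)))))

  covers : ∀ c → ∃ λ i → f i ≡ family c
  covers c = Product.map₂ (λ code-i≡c → trans (proj₂ (classify _)) (cong family code-i≡c))
                          (injective⇒surjective code code-injective c)

  family-injective : Injective _≡_ _≡_ family
  family-injective {c} {c′} eq
    with i , refl ← injective⇒surjective code code-injective c
       | j , refl ← injective⇒surjective code code-injective c′
    = cong code (f-injective (trans (proj₂ (classify i)) (trans eq (sym (proj₂ (classify j))))))

enumerate : Fin 8 → 𝐑
enumerate = lookup (α₁ ∷ β₁ ∷ β₂ ∷ β₃ ∷ β₄ ∷ γ₁ ∷ γ₂ ∷ γ₃ ∷ [])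

position : 𝐑 → Fin 8
position α₁ = zero
position β₁ = suc zero
position β₂ = suc (suc zero)
position β₃ = suc (suc (suc zero))
position β₄ = suc (suc (suc (suc zero)))
position γ₁ = suc (suc (suc (suc (suc zero))))
position γ₂ = suc (suc (suc (suc (suc (suc zero)))))
position γ₃ = suc (suc (suc (suc (suc (suc (suc zero))))))

position∘enumerate : ∀ i → position (enumerate i) ≡ i
position∘enumerate zero                                            = refl
position∘enumerate (suc zero)                                      = refl
position∘enumerate (suc (suc zero))                                = refl
position∘enumerate (suc (suc (suc zero)))                          = refl
position∘enumerate (suc (suc (suc (suc zero))))                    = refl
position∘enumerate (suc (suc (suc (suc (suc zero)))))              = refl
position∘enumerate (suc (suc (suc (suc (suc (suc zero))))))        = refl
position∘enumerate (suc (suc (suc (suc (suc (suc (suc zero)))))))  = refl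

enumerate-injective : Injective _≡_ _≡_ enumerate
enumerate-injective {i} {j} eq =
  trans (sym (position∘enumerate i)) (trans (cong position eq) (position∘enumerate j))

β : Fin 4 → 𝐑
β i = enumerate (suc (i ↑ˡ 3))

β-injective : Injective _≡_ _≡_ β
β-injective {i} {j} = Fin.↑ˡ-injective 3 i j ∘ Fin.suc-injective ∘ enumerate-injective

rank𝐑∘β : ∀ i → rank𝐑 (β i) ≡ 1
rank𝐑∘β zero                   = refl
rank𝐑∘β (suc zero)             = refl
rank𝐑∘β (suc (suc zero))       = refl
rank𝐑∘β (suc (suc (suc zero))) = refl

below-α₁ : ∀ x → x ≤𝐑 α₁
below-α₁ α₁ = ε
below-α₁ β₁ = β₁⋖α₁ ◅ ε
below-α₁ β₂ = β₂⋖α₁ ◅ ε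
below-α₁ β₃ = β₃⋖α₁ ◅ ε
below-α₁ β₄ = β₄⋖α₁ ◅ ε
below-α₁ γ₁ = γ₁⋖β₁ ◅ β₁⋖α₁ ◅ ε
below-α₁ γ₂ = γ₂⋖β₁ ◅ β₁⋖α₁ ◅ ε
below-α₁ γ₃ = γ₃⋖β₃ ◅ β₃⋖α₁ ◅ ε

γ₂≤β : ∀ i → γ₂ ≤𝐑 β i
γ₂≤β zero                   = γ₂⋖β₁ ◅ ε
γ₂≤β (suc zero)             = γ₂⋖β₂ ◅ ε
γ₂≤β (suc (suc zero))       = γ₂⋖β₃ ◅ ε
γ₂≤β (suc (suc (suc zero))) = γ₂⋖β₄ ◅ ε

module _ (Γ : Graph) where
  open Graph Γ using (src; tgt)

  shared-ends : ∀ {a b} → src b ≢ tgt b → Incident Γ (src b) a → Incident Γ (tgt b) a →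
    Incident Γ (src a) b × Incident Γ (tgt a) b
  shared-ends b-not-loop (inj₁ p) (inj₁ q) = ⊥-elim (b-not-loop (trans (sym p) q))
  shared-ends b-not-loop (inj₁ p) (inj₂ q) = inj₁ (sym p) , inj₂ (sym q)
  shared-ends b-not-loop (inj₂ p) (inj₁ q) = inj₂ (sym q) , inj₁ (sym p)
  shared-ends b-not-loop (inj₂ p) (inj₂ q) = ⊥-elim (b-not-loop (trans (sym p) q))

  lookup-addAt : ∀ z D v → lookup (addAt Γ z D) v ≡ lookup D v + + 𝟙 (eqF z v)
  lookup-addAt z D v with z ≟ v
  ... | yes refl = lookup∘updateAt z D
  ... | no z≢v   = trans (lookup∘updateAt′ v z (z≢v ∘ sym) D) (sym (ℤ.+-identityʳ _))

  lookup-addAt² : ∀ z z′ D v →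
    lookup (addAt Γ z′ (addAt Γ z D)) v ≡ lookup D v + + (𝟙 (eqF z v) ℕ.+ 𝟙 (eqF z′ v))
  lookup-addAt² z z′ D v = begin
    lookup (addAt Γ z′ (addAt Γ z D)) v
      ≡⟨ lookup-addAt z′ (addAt Γ z D) v ⟩
    lookup (addAt Γ z D) v + + 𝟙 (eqF z′ v)
      ≡⟨ cong (_+ + 𝟙 (eqF z′ v)) (lookup-addAt z D v) ⟩
    lookup D v + + 𝟙 (eqF z v) + + 𝟙 (eqF z′ v)
      ≡⟨ ℤ.+-assoc (lookup D v) _ _ ⟩
    lookup D v + (+ 𝟙 (eqF z v) + + 𝟙 (eqF z′ v))
      ≡⟨ cong (λ n → lookup D v + n) (sym (ℤ.pos-+ (𝟙 (eqF z v)) (𝟙 (eqF z′ v)))) ⟩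
    lookup D v + + (𝟙 (eqF z v) ℕ.+ 𝟙 (eqF z′ v))
      ∎
    where open ≡-Reasoning

  addAt-comm : ∀ z z′ D → addAt Γ z′ (addAt Γ z D) ≡ addAt Γ z (addAt Γ z′ D)
  addAt-comm z z′ D = Pointwise-≡⇒≡ (ext λ v → begin
    lookup (addAt Γ z′ (addAt Γ z D)) v
      ≡⟨ lookup-addAt² z z′ D v ⟩
    lookup D v + + (𝟙 (eqF z v) ℕ.+ 𝟙 (eqF z′ v))
      ≡⟨ cong (λ n → lookup D v + + n) (ℕ.+-comm (𝟙 (eqF z v)) (𝟙 (eqF z′ v))) ⟩
    lookup D v + + (𝟙 (eqF z′ v) ℕ.+ 𝟙 (eqF z v))
      ≡⟨ sym (lookup-addAt² z′ z D v) ⟩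
    lookup (addAt Γ z (addAt Γ z′ D)) v
      ∎)
    where open ≡-Reasoning

  addAt²-cross : ∀ {x x′ y y′} D → addAt Γ y (addAt Γ x D) ≡ addAt Γ y′ (addAt Γ x′ D) →
    x ≢ x′ → y′ ≡ x
  addAt²-cross {x} {x′} {y} {y′} D eq x≢x′ = eqF⇒≡ (𝟙≡suc⇒true (sym at-x′))
    where
    at-x : 𝟙 (eqF x x) ℕ.+ 𝟙 (eqF y x) ≡ 𝟙 (eqF x′ x) ℕ.+ 𝟙 (eqF y′ x)
    at-x = ℤ.+-injective (∙-cancelˡ (lookup D x) _ _
      (trans (sym (lookup-addAt² x y D x))
        (trans (cong (λ V → lookup V x) eq) (lookup-addAt² x′ y′ D x))))

    at-x′ : suc (𝟙 (eqF y x)) ≡ 𝟙 (eqF y′ x)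
    at-x′ = subst₂ (λ b b′ → 𝟙 b ℕ.+ 𝟙 (eqF y x) ≡ 𝟙 b′ ℕ.+ 𝟙 (eqF y′ x))
      (eqF-refl x) (eqF-≢ (x≢x′ ∘ sym)) at-x

  ≤Q-drop-one : ∀ {q p} a → _≤Q_ Γ q p →
    (∀ e → inℰ Γ p e ∧ not (inℰ Γ q e) ≡ eqF a e) →
    ∃ λ z → Incident Γ z a × Dv q ≡ addAt Γ z (Dv p)
  ≤Q-drop-one {q} {p} a (_ , φ , φ-incident , Dv-q) dropped =
    φ a , uncurry (φ-incident a) (∧-not≡true (trans (dropped a) (eqF-refl a))) ,
    Pointwise-≡⇒≡ (ext λ v → begin
      lookup (Dv q) v                       ≡⟨ Dv-q v ⟩
      lookup (Dv p) v + + countF (moved v)  ≡⟨ cong (λ n → lookup (Dv p) v + + n) (count-moved v) ⟩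
      lookup (Dv p) v + + 𝟙 (eqF (φ a) v)   ≡⟨ sym (lookup-addAt (φ a) (Dv p) v) ⟩
      lookup (addAt Γ (φ a) (Dv p)) v       ∎)
    where
    open ≡-Reasoning
    moved : Vertex Γ → Edge Γ → Bool
    moved v e = inℰ Γ p e ∧ not (inℰ Γ q e) ∧ eqF (φ e) v

    count-moved : ∀ v → countF (moved v) ≡ 𝟙 (eqF (φ a) v)
    count-moved v = trans
      (countF-cong λ e → trans (sym (∧-assoc (inℰ Γ p e) _ _)) (cong (_∧ eqF (φ e) v) (dropped e)))
      (countF-singleton a (λ e → eqF (φ e) v))

  ≤Q-drop-two : ∀ {q p a b} → a ≢ b → _≤Q_ Γ q p →
    (∀ e → inℰ Γ p e ∧ not (inℰ Γ q e) ≡ eqF a e ∨ eqF b e) →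
    ∃₂ λ z z′ → Incident Γ z a × Incident Γ z′ b × Dv q ≡ addAt Γ z′ (addAt Γ z (Dv p))
  ≤Q-drop-two {q} {p} {a} {b} a≢b (_ , φ , φ-incident , Dv-q) dropped =
    φ a , φ b ,
    incident a (trans (dropped a) (cong (_∨ eqF b a) (eqF-refl a))) ,
    incident b (trans (dropped b) (trans (cong (_∨ eqF b b) (eqF-≢ a≢b)) (eqF-refl b))) ,
    Pointwise-≡⇒≡ (ext λ v → begin
      lookup (Dv q) v
        ≡⟨ Dv-q v ⟩
      lookup (Dv p) v + + countF (moved v)
        ≡⟨ cong (λ n → lookup (Dv p) v + + n) (count-moved v) ⟩
      lookup (Dv p) v + + (𝟙 (eqF (φ a) v) ℕ.+ 𝟙 (eqF (φ b) v))
        ≡⟨ sym (lookup-addAt² (φ a) (φ b) (Dv p) v) ⟩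
      lookup (addAt Γ (φ b) (addAt Γ (φ a) (Dv p))) v
        ∎)
    where
    open ≡-Reasoning
    incident : ∀ e → inℰ Γ p e ∧ not (inℰ Γ q e) ≡ true → Incident Γ (φ e) e
    incident e = uncurry (φ-incident e) ∘ ∧-not≡true

    moved : Vertex Γ → Edge Γ → Bool
    moved v e = inℰ Γ p e ∧ not (inℰ Γ q e) ∧ eqF (φ e) v

    count-moved : ∀ v → countF (moved v) ≡ 𝟙 (eqF (φ a) v) ℕ.+ 𝟙 (eqF (φ b) v)
    count-moved v = begin
      countF (moved v)
        ≡⟨ countF-cong split ⟩
      countF (λ e → (eqF a e ∧ at v e) ∨ (eqF b e ∧ at v e))
        ≡⟨ countF-∨ _ _ (λ e → eqF-disjoint a≢b e (at v)) ⟩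
      countF (λ e → eqF a e ∧ at v e) ℕ.+ countF (λ e → eqF b e ∧ at v e)
        ≡⟨ cong₂ ℕ._+_ (countF-singleton a (at v)) (countF-singleton b (at v)) ⟩
      𝟙 (eqF (φ a) v) ℕ.+ 𝟙 (eqF (φ b) v)
        ∎
      where
      at : Vertex Γ → Edge Γ → Bool
      at v e = eqF (φ e) v
      split : ∀ e → moved v e ≡ (eqF a e ∧ at v e) ∨ (eqF b e ∧ at v e)
      split e = trans (sym (∧-assoc (inℰ Γ p e) _ _))
        (trans (cong (_∧ at v e) (dropped e)) (∧-distribʳ-∨ (at v e) (eqF a e) (eqF b e)))

  dropped-to-⊥ : ∀ {q p} → ℰ q ≡ ⊥ → ∀ e → inℰ Γ p e ∧ not (inℰ Γ q e) ≡ inℰ Γ p e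
  dropped-to-⊥ {q} {p} ℰ-q e =
    trans (cong (λ E → inℰ Γ p e ∧ not (lookup E e)) ℰ-q)
      (trans (cong (λ b → inℰ Γ p e ∧ not b) (lookup-replicate e false)) (∧-identityʳ _))

  ≤Q-pair→single : ∀ {q p a b} → a ≢ b → ℰ p ≡ ⁅ a ⁆ ∪ ⁅ b ⁆ → ℰ q ≡ ⁅ a ⁆ → _≤Q_ Γ q p →
    ∃ λ z → Incident Γ z b × q ≡ pdiv ⁅ a ⁆ (addAt Γ z (Dv p))
  ≤Q-pair→single {q} {p} {a} {b} a≢b ℰ-p ℰ-q q≤p =
    Product.map₂ (Product.map₂ (cong₂ pdiv ℰ-q)) (≤Q-drop-one b q≤p dropped)
    where
    dropped : ∀ e → inℰ Γ p e ∧ not (inℰ Γ q e) ≡ eqF b e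
    dropped e rewrite ℰ-p | ℰ-q | lookup-⁅⁆∪⁅⁆ a b e | lookup-⁅⁆ a e with a ≟ e
    ... | yes refl = sym (eqF-≢ (a≢b ∘ sym))
    ... | no _     = ∧-identityʳ (eqF b e)

  ≤Q-single→∅ : ∀ {q p a} → ℰ p ≡ ⁅ a ⁆ → ℰ q ≡ ⊥ → _≤Q_ Γ q p →
    ∃ λ z → Incident Γ z a × Dv q ≡ addAt Γ z (Dv p)
  ≤Q-single→∅ {q} {p} {a} ℰ-p ℰ-q q≤p = ≤Q-drop-one a q≤p λ e →
    trans (dropped-to-⊥ {q} {p} ℰ-q e) (trans (cong (λ E → lookup E e) ℰ-p) (lookup-⁅⁆ a e))

  ≤Q-pair→∅ : ∀ {q p a b} → a ≢ b → ℰ p ≡ ⁅ a ⁆ ∪ ⁅ b ⁆ → ℰ q ≡ ⊥ → _≤Q_ Γ q p →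
    ∃₂ λ z z′ → Incident Γ z a × Incident Γ z′ b × q ≡ pdiv ⊥ (addAt Γ z′ (addAt Γ z (Dv p)))
  ≤Q-pair→∅ {q} {p} {a} {b} a≢b ℰ-p ℰ-q q≤p =
    Product.map₂ (Product.map₂ (Product.map₂ (Product.map₂ (cong₂ pdiv ℰ-q))))
      (≤Q-drop-two a≢b q≤p λ e →
        trans (dropped-to-⊥ {q} {p} ℰ-q e)
          (trans (cong (λ E → lookup E e) ℰ-p) (lookup-⁅⁆∪⁅⁆ a b e)))

module Image (Γ : Graph) (g : 𝐑 → PDiv Γ)
  (monotone : ∀ x y → x ≤𝐑 y → _≤Q_ Γ (g x) (g y))
  (rank-g : ∀ x → rank Γ (g x) ≡ rank𝐑 x)
  (g-injective : ∀ x y → g x ≡ g y → x ≡ y)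
  {e₁ e₂ : Edge Γ} (e₁≢e₂ : e₁ ≢ e₂) (ℰ-top : ℰ (g α₁) ≡ ⁅ e₁ ⁆ ∪ ⁅ e₂ ⁆)
  where
  open Graph Γ using (src; tgt)

  D : Vec ℤ (Graph.nV Γ)
  D = Dv (g α₁)

  s t : Vertex Γ
  s = src e₁
  t = tgt e₁

  g-top : g α₁ ≡ pdiv (⁅ e₁ ⁆ ∪ ⁅ e₂ ⁆) D
  g-top = cong (λ E → pdiv E D) ℰ-top

  below-top : ∀ x → _≤Q_ Γ (g x) (g α₁)
  below-top x = monotone x α₁ (below-α₁ x)

  candidate : Fin 4 → PDiv Γ
  candidate zero                   = pdiv ⁅ e₁ ⁆ (addAt Γ (src e₂) D)
  candidate (suc zero)             = pdiv ⁅ e₁ ⁆ (addAt Γ (tgt e₂) D)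
  candidate (suc (suc zero))       = pdiv ⁅ e₂ ⁆ (addAt Γ s D)
  candidate (suc (suc (suc zero))) = pdiv ⁅ e₂ ⁆ (addAt Γ t D)

  rank1⇒candidate : ∀ x → rank Γ (g x) ≡ 1 → ∃ λ c → g x ≡ candidate c
  rank1⇒candidate x r
    with ∣p∣≡1∧p⊆⁅x⁆∪⁅y⁆ r (subst (ℰ (g x) ⊆_) ℰ-top (proj₁ (below-top x)))
  ... | inj₁ ℰ≡⁅e₁⁆ with ≤Q-pair→single Γ e₁≢e₂ ℰ-top ℰ≡⁅e₁⁆ (below-top x)
  ...   | _ , inj₁ refl , eq = zero , eq
  ...   | _ , inj₂ refl , eq = suc zero , eq
  rank1⇒candidate x r
      | inj₂ ℰ≡⁅e₂⁆
      with ≤Q-pair→single Γ (e₁≢e₂ ∘ sym) (trans ℰ-top (∪-comm ⁅ e₁ ⁆ ⁅ e₂ ⁆)) ℰ≡⁅e₂⁆ (below-top x)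
  ...   | _ , inj₁ refl , eq = suc (suc zero) , eq
  ...   | _ , inj₂ refl , eq = suc (suc (suc zero)) , eq

  module Candidates = InjectionIntoFamily (g ∘ β) candidate
    (λ eq → β-injective (g-injective _ _ eq))
    (λ i → rank1⇒candidate (β i) (trans (rank-g (β i)) (rank𝐑∘β i)))

  s≢t : s ≢ t
  s≢t eq with Candidates.family-injective {suc (suc zero)} {suc (suc (suc zero))}
                (cong (λ z → pdiv ⁅ e₂ ⁆ (addAt Γ z D)) eq)
  ... | ()

  e₂-not-loop : src e₂ ≢ tgt e₂
  e₂-not-loop eq with Candidates.family-injective {zero} {suc zero}
                        (cong (λ z → pdiv ⁅ e₁ ⁆ (addAt Γ z D)) eq)
  ... | ()

  γ₂-over : Vertex Γ → Set
  γ₂-over z = ∃ λ w → Incident Γ w e₁ × Dv (g γ₂) ≡ addAt Γ w (addAt Γ z D)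

  γ₂-below : ∀ z → (∃ λ i → g (β i) ≡ pdiv ⁅ e₁ ⁆ (addAt Γ z D)) → γ₂-over z
  γ₂-below z (i , gβi≡) =
    Product.map₂ (Product.map₂ (λ eq → trans eq (cong (λ p → addAt Γ _ (Dv p)) gβi≡)))
      (≤Q-single→∅ Γ (cong ℰ gβi≡) (∣p∣≡0⇒p≡⊥ _ (rank-g γ₂)) (monotone γ₂ (β i) (γ₂≤β i)))

  γ₂-over-both-ends : γ₂-over (src e₂) → γ₂-over (tgt e₂) →
    Incident Γ (src e₂) e₁ × Incident Γ (tgt e₂) e₁
  γ₂-over-both-ends (w , w-incident , via-src) (w′ , w′-incident , via-tgt) =
    subst (λ z → Incident Γ z e₁)
      (addAt²-cross Γ D (trans (sym via-src) via-tgt) e₂-not-loop) w′-incident ,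
    subst (λ z → Incident Γ z e₁)
      (addAt²-cross Γ D (trans (sym via-tgt) via-src) (e₂-not-loop ∘ sym)) w-incident

  e₂-ends-on-e₁ : Incident Γ (src e₂) e₁ × Incident Γ (tgt e₂) e₁
  e₂-ends-on-e₁ = γ₂-over-both-ends (γ₂-below (src e₂) (Candidates.covers zero))
                                    (γ₂-below (tgt e₂) (Candidates.covers (suc zero)))

  e₂-incident : Incident Γ s e₂ × Incident Γ t e₂
  e₂-incident = uncurry (shared-ends Γ e₂-not-loop) e₂-ends-on-e₁

  on-e₁ : ∀ {z} → Incident Γ z e₂ → Incident Γ z e₁
  on-e₁ (inj₁ refl) = proj₁ e₂-ends-on-e₁
  on-e₁ (inj₂ refl) = proj₂ e₂-ends-on-e₁

  R : List (PDiv Γ)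
  R = RList Γ e₁ e₂ s t D

  single-e₁∈R : ∀ {z} → Incident Γ z e₁ → pdiv ⁅ e₁ ⁆ (addAt Γ z D) ∈ R
  single-e₁∈R (inj₁ refl) = there (here refl)
  single-e₁∈R (inj₂ refl) = there (there (here refl))

  candidate∈R : ∀ c → candidate c ∈ R
  candidate∈R zero                   = single-e₁∈R (proj₁ e₂-ends-on-e₁)
  candidate∈R (suc zero)             = single-e₁∈R (proj₂ e₂-ends-on-e₁)
  candidate∈R (suc (suc zero))       = there (there (there (here refl)))
  candidate∈R (suc (suc (suc zero))) = there (there (there (there (here refl))))

  empty∈R : ∀ {z z′} → Incident Γ z e₁ → Incident Γ z′ e₁ →
    pdiv ⊥ (addAt Γ z′ (addAt Γ z D)) ∈ R
  empty∈R z-incident z′-incident =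
    subst (λ E → pdiv E (addAt Γ _ (addAt Γ _ D)) ∈ R) tabulate-false≡⊥
      (on-ends z-incident z′-incident)
    where
    ∅ : Subset (Graph.nE Γ)
    ∅ = tabulate (λ _ → false)

    on-ends : ∀ {z z′} → Incident Γ z e₁ → Incident Γ z′ e₁ →
      pdiv ∅ (addAt Γ z′ (addAt Γ z D)) ∈ R
    on-ends (inj₁ refl) (inj₁ refl) = there (there (there (there (there (here refl)))))
    on-ends (inj₁ refl) (inj₂ refl) =
      there (there (there (there (there (there (here (cong (pdiv ∅) (addAt-comm Γ s t D))))))))
    on-ends (inj₂ refl) (inj₁ refl) = there (there (there (there (there (there (here refl))))))
    on-ends (inj₂ refl) (inj₂ refl) =
      there (there (there (there (there (there (there (here refl)))))))

  rank1∈R : ∀ x → rank Γ (g x) ≡ 1 → g x ∈ R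
  rank1∈R x r with c , eq ← rank1⇒candidate x r = subst (_∈ R) (sym eq) (candidate∈R c)

  rank0∈R : ∀ x → rank Γ (g x) ≡ 0 → g x ∈ R
  rank0∈R x r
    with z , z′ , z-incident , z′-incident , eq ←
         ≤Q-pair→∅ Γ e₁≢e₂ ℰ-top (∣p∣≡0⇒p≡⊥ _ r) (below-top x)
    = subst (_∈ R) (sym eq) (empty∈R z-incident (on-e₁ z′-incident))

  image⊆R : ∀ x → g x ∈ R
  image⊆R α₁ = here g-top
  image⊆R β₁ = rank1∈R β₁ (rank-g β₁)
  image⊆R β₂ = rank1∈R β₂ (rank-g β₂)
  image⊆R β₃ = rank1∈R β₃ (rank-g β₃)
  image⊆R β₄ = rank1∈R β₄ (rank-g β₄)
  image⊆R γ₁ = rank0∈R γ₁ (rank-g γ₁)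
  image⊆R γ₂ = rank0∈R γ₂ (rank-g γ₂)
  image⊆R γ₃ = rank0∈R γ₃ (rank-g γ₃)

  module Onto = InjectionIntoFamily (g ∘ enumerate) (List.lookup R)
    (λ eq → enumerate-injective (g-injective _ _ eq))
    (λ i → index (image⊆R (enumerate i)) , lookup-index (image⊆R (enumerate i)))

  R⊆image : ∀ p → p ∈ R → ∃ λ x → g x ≡ p
  R⊆image p p∈R with i , eq ← Onto.covers (index p∈R) =
    enumerate i , trans eq (sym (lookup-index p∈R))

proposition4p5 : (Γ : Graph) (v₀ : Vertex Γ) (g : 𝐑 → PDiv Γ) →
    (∀ x → QuasiStable Γ v₀ (g x)) →
    (∀ x y → x ≤𝐑 y → _≤Q_ Γ (g x) (g y)) →
    (∀ x → rank Γ (g x) ≡ rank𝐑 x) →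
    (∀ x y → g x ≡ g y → x ≡ y) →
    Σ (Edge Γ) λ e₁ → Σ (Edge Γ) λ e₂ → Σ (Vertex Γ) λ s → Σ (Vertex Γ) λ t →
    Σ (Vec ℤ (Graph.nV Γ)) λ D →
      ¬ (e₁ ≡ e₂) × ¬ (s ≡ t) ×
      Incident Γ s e₁ × Incident Γ t e₁ × Incident Γ s e₂ × Incident Γ t e₂ ×
      QuasiStable Γ v₀ (pdiv (⁅ e₁ ⁆ ∪ ⁅ e₂ ⁆) D) ×
      g α₁ ≡ pdiv (⁅ e₁ ⁆ ∪ ⁅ e₂ ⁆) D ×
      (∀ p → (Σ 𝐑 λ x → g x ≡ p) ⇔ p ∈ RList Γ e₁ e₂ s t D)
proposition4p5 Γ v₀ g quasistable monotone rank-g g-injective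
  with e₁ , e₂ , e₁≢e₂ , ℰ-top ← ∣p∣≡2⇒p≡⁅x⁆∪⁅y⁆ (ℰ (g α₁)) (rank-g α₁) =
  e₁ , e₂ , s , t , D , e₁≢e₂ , s≢t ,
  inj₁ refl , inj₂ refl , proj₁ e₂-incident , proj₂ e₂-incident ,
  subst (QuasiStable Γ v₀) g-top (quasistable α₁) , g-top ,
  λ p → mk⇔ (λ { (x , refl) → image⊆R x }) (R⊆image p)
  where open Image Γ g monotone rank-g g-injective e₁≢e₂ ℰ-top
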